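{- Consider the equation \[ \sqrt{t \left(1 - \frac{1}{A^2}\right)\left(1 - \frac{1}{x^2}\right)\left(1 - \frac{1}{y^2}\right)\left(1 - \frac{1}{z^2}\right)} = \left(1 + \frac{1}{x}\right)\left(1 + \frac{1}{y}\right)\left(1 + \frac{1}{z}\right). \qquad (\ast) \] (a) There are only finitely many tuples $(t,A,x,y,z)$ of integers, all greater than $1$, with $x\le y\le z$, satisfying $(\ast)$. (b) There are infinitely many tuples $(t,A,x,y,z)$ of integers with $t\neq 0$ and $A,x,y,z\notin\{0,1,-1\}$ satisfying $(\ast)$.
   Context: A perfect Ramanujan identity is an instance of $(\ast)$ in which $t,A,x,y,z$ are all positive integers greater than $1$; a general Ramanujan identity is an instance of $(\ast)$ in which $t,A,x,y,z$ are integers with $t\neq0$ and $A,x,y,z\notin\{0,\pm1\}$. The paper orders the variables so that $x\le y\le z$. -}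

module Defs where

open import Data.Integer using (ℤ; +_; -_; _+_; _-_; _*_; _≤_; _<_)
open import Data.Product using (_×_; _,_)
open import Data.Sum using (_⊎_)
open import Relation.Binary.PropositionalEquality using (_≡_)
open import Relation.Nullary using (¬_)

Tuple : Set
Tuple = ℤ × ℤ × ℤ × ℤ × ℤ

sq : ℤ → ℤ
sq a = a * a

-- Equation (*):
--   sqrt( t (1-1/A²)(1-1/x²)(1-1/y²)(1-1/z²) ) = (1+1/x)(1+1/y)(1+1/z)
-- For integers A,x,y,z ∉ {0,±1} the right-hand side is > 0, so (*) is
-- equivalent to the squared equation; multiplying by A²x²y²z² (nonzero)
-- gives the equivalent integer equation below.
RamanujanEq : ℤ → ℤ → ℤ → ℤ → ℤ → Set
RamanujanEq t A x y z =
  t * (sq A - + 1) * (sq x - + 1) * (sq y - + 1) * (sq z - + 1)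
    ≡ sq A * sq (x + + 1) * sq (y + + 1) * sq (z + + 1)

Perfect : Tuple → Set
Perfect (t , A , x , y , z) =
  (+ 1 < t) × (+ 1 < A) × (+ 1 < x) × (+ 1 < y) × (+ 1 < z)
  × (x ≤ y) × (y ≤ z) × RamanujanEq t A x y z

NotUnitOrZero : ℤ → Set
NotUnitOrZero a = ¬ (a ≡ + 0 ⊎ a ≡ + 1 ⊎ a ≡ - (+ 1))

General : Tuple → Set
General (t , A , x , y , z) =
  ¬ (t ≡ + 0) × NotUnitOrZero A × NotUnitOrZero x × NotUnitOrZero y
  × NotUnitOrZero z × RamanujanEq t A x y z

{-# OPTIONS --safe #-}
module Submission where

-- Write x = 1 + a, y = 1 + b, z = 1 + c and U = A².  For perfect tuples (∗) squared and divided
-- by (2 + a)(2 + b)(2 + c) is the natural-number equation  U t abc = U (2 + a)(2 + b)(2 + c) + t abc.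
-- Fixing t, a, b in turn, it takes the form  U h X = U q (X + D) + h X,  i.e. (U g − h) X = U q D
-- with g = h − q.  As (V g − h) / V increases with V, the least square V with V g > h, which is at
-- most U, bounds the next variable by the fixed ones: (3t − 4) a ≤ 104 (so t ≤ 36),
-- (V g − h) b ≤ 8 V q and (V g − h) c ≤ 2 V q.  On the resulting finite search A is determined by
-- U (t abc − (2 + a)(2 + b)(2 + c)) = t abc, and evaluation finds 309 perfect identities.
-- For (b), (t, A, x, y, z) = (2, 2, n, 5, −n) solves (∗) for every n.

open import Defs
open import Data.Bool using (Bool; true; false; T)
open import Data.Bool.ListAction using (all)
open import Data.Empty using (⊥)
open import Data.Integer as ℤ using (+<+; +≤+)
open import Data.Integer.Properties using (+-injective)
import Data.Integer.Tactic.RingSolver as ℤSolver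
open import Data.List using (List; []; _∷_; map; applyUpTo)
open import Data.List.Membership.Propositional using (_∈_; _∉_)
open import Data.List.Membership.Propositional.Properties using (∈-applyUpTo⁺; ∈-map⁺)
open import Data.List.Relation.Unary.All using (lookup)
open import Data.List.Relation.Unary.All.Properties using (all⁺)
open import Data.List.Relation.Unary.Any using (here; there)
open import Data.Nat
open import Data.Nat.DivMod using (m*n/n≡m; /-monoˡ-≤)
open import Data.Nat.Properties
open import Data.Nat.Tactic.RingSolver using (solve-∀)
open import Data.Product using (_×_; _,_; Σ; ∃)
open import Data.Product.Properties using (≡-dec)
open import Data.Sum using (inj₁; inj₂)
open import Data.Unit using (tt)
open import Relation.Binary.Definitions using (DecidableEquality)
open import Relation.Binary.PropositionalEquality
open import Relation.Nullary using (Dec; yes; no; contradiction)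
open import Relation.Nullary.Decidable using (isYes; _→-dec_; toWitness)

interval : ℕ → ℕ → List ℕ
interval lo hi = applyUpTo (lo +_) (suc hi ∸ lo)

∈-interval : ∀ {lo hi n} → lo ≤ n → n ≤ hi → n ∈ interval lo hi
∈-interval {lo} {hi} {n} lo≤n n≤hi =
  subst (_∈ interval lo hi) (m+[n∸m]≡n lo≤n) (∈-applyUpTo⁺ (lo +_) (∸-monoˡ-< (s≤s n≤hi) lo≤n))

all-interval : ∀ {lo hi n} (p : ℕ → Bool) → T (all p (interval lo hi)) → lo ≤ n → n ≤ hi → T (p n)
all-interval p ok lo≤n n≤hi = lookup (all⁺ p _ ok) (∈-interval lo≤n n≤hi)

allWithin : (f K lo : ℕ) → (ℕ → Bool) → Bool
allWithin zero      _ _  _ = false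
allWithin f@(suc _) K lo p = all p (interval lo (K / f))

allWithin-sound : ∀ {f K lo v} (p : ℕ → Bool) → T (allWithin f K lo p) → lo ≤ v → f * v ≤ K → T (p v)
allWithin-sound {f@(suc _)} {K} {v = v} p ok lo≤v fv≤K = all-interval p ok lo≤v (begin
  v          ≡⟨ m*n/n≡m v f ⟨
  v * f / f  ≤⟨ /-monoˡ-≤ f (≤-trans (≤-reflexive (*-comm v f)) fv≤K) ⟩
  K / f      ∎)
  where open ≤-Reasoning

rootFrom : (g h r k : ℕ) → ℕ
rootFrom g h r zero    = r
rootFrom g h r (suc k) with h <? r * r * g
... | yes _ = r
... | no  _ = rootFrom g h (suc r) k

-- The least r with h < r² g; linear search, for which fuel suc h suffices when g > 0.
rootAbove : ℕ → ℕ → ℕ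
rootAbove zero      h = 0
rootAbove g@(suc _) h = rootFrom g h 0 (suc h)

rootFrom-least : ∀ {g h r A} k → r ≤ A → h < A * A * g → rootFrom g h r k ≤ A
rootFrom-least zero r≤A _ = r≤A
rootFrom-least {g} {h} {r} (suc k) r≤A h<AAg with h <? r * r * g
... | yes _     = r≤A
... | no  h≮rrg = rootFrom-least k r<A h<AAg
  where
  r<A = ≰⇒> λ A≤r → h≮rrg (<-≤-trans h<AAg (*-monoˡ-≤ g (*-mono-≤ A≤r A≤r)))

rootFrom-above : ∀ {g h r} k → h < (r + k) * (r + k) * g → h < rootFrom g h r k * rootFrom g h r k * g
rootFrom-above {r = r} zero h< rewrite +-identityʳ r = h<
rootFrom-above {g} {h} {r} (suc k) h< with h <? r * r * g
... | yes h<rrg = h<rrg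
... | no  _     = rootFrom-above k (subst (λ s → h < s * s * g) (+-suc r k) h<)

rootAbove-least : ∀ {g h A} → h < A * A * g → rootAbove g h ≤ A
rootAbove-least {zero}        _     = z≤n
rootAbove-least {suc _} {h} h<AAg = rootFrom-least (suc h) z≤n h<AAg

rootAbove-above : ∀ g h .{{_ : NonZero g}} → h < rootAbove g h * rootAbove g h * g
rootAbove-above g@(suc _) h = rootFrom-above {g} {h} {0} (suc h)
  (≤-trans (m≤m*n (suc h) (suc h)) (m≤m*n (suc h * suc h) g))

rootAbove-exact : ∀ A d .{{_ : NonZero d}} → rootAbove d (A * A * d) ≡ suc A
rootAbove-exact A d =
  ≤-antisym (rootAbove-least {d} {A * A * d} {suc A} (*-monoˡ-< d (*-mono-< (n<1+n A) (n<1+n A)))) A<r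
  where
  r = rootAbove d (A * A * d)
  AA<rr : A * A < r * r
  AA<rr = *-cancelʳ-< d (A * A) (r * r) (rootAbove-above d (A * A * d))
  A<r : A < r
  A<r = ≰⇒> λ r≤A → <⇒≱ AA<rr (*-mono-≤ r≤A r≤A)

-- The reduced equation once its leading variables are fixed: h is t times their product, q the
-- product of the 2 + (fixed variable), v the next variable, w the product of the later ones, and
-- v w + D the product of the 2 + (remaining variable).
module Level {U h q v w D : ℕ} (eq : U * h * (v * w) ≡ U * q * (v * w + D) + h * (v * w)) where

  excess-eq : U * (h ∸ q) * (v * w) ≡ U * q * D + h * (v * w)
  excess-eq = begin
    U * (h ∸ q) * X                              ≡⟨ cong (_* X) (*-distribˡ-∸ U h q) ⟩
    (U * h ∸ U * q) * X                          ≡⟨ *-distribʳ-∸ X (U * h) (U * q) ⟩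
    U * h * X ∸ U * q * X                        ≡⟨ cong (_∸ U * q * X) (trans eq (split U q X D (h * X))) ⟩
    U * q * X + (U * q * D + h * X) ∸ U * q * X  ≡⟨ m+n∸m≡n (U * q * X) _ ⟩
    U * q * D + h * X                            ∎
    where
    open ≡-Reasoning
    X = v * w
    split : ∀ U q X D Y → U * q * (X + D) + Y ≡ U * q * X + (U * q * D + Y)
    split = solve-∀

  excess-pos : 0 < U * q * D → h < U * (h ∸ q)
  excess-pos 0<UqD = ≰⇒> λ Ug≤h → <⇒≱ 0<UqD (+-cancelʳ-≤ (h * X) (U * q * D) 0 (begin
    U * q * D + h * X  ≡⟨ excess-eq ⟨
    U * (h ∸ q) * X    ≤⟨ *-monoˡ-≤ X Ug≤h ⟩
    h * X              ∎))
    where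
    open ≤-Reasoning
    X = v * w

  -- (V g − h) / V = g − h / V increases with V, and equals q D / X at V = U.
  excess-mono : ∀ {V} .{{_ : NonZero U}} → V ≤ U → (V * (h ∸ q) ∸ h) * (v * w) ≤ V * q * D
  excess-mono {V} V≤U = *-cancelˡ-≤ U (begin
    U * ((V * g ∸ h) * X)            ≡⟨ cong (U *_) (*-distribʳ-∸ X (V * g) h) ⟩
    U * (V * g * X ∸ h * X)          ≡⟨ *-distribˡ-∸ U (V * g * X) (h * X) ⟩
    U * (V * g * X) ∸ U * (h * X)    ≤⟨ ∸-monoʳ-≤ (U * (V * g * X)) (*-monoˡ-≤ (h * X) V≤U) ⟩
    U * (V * g * X) ∸ V * (h * X)    ≡⟨ cong (_∸ V * (h * X)) (swap U V g X) ⟩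
    V * (U * g * X) ∸ V * (h * X)    ≡⟨ *-distribˡ-∸ V (U * g * X) (h * X) ⟨
    V * (U * g * X ∸ h * X)          ≡⟨ cong (λ e → V * (e ∸ h * X)) excess-eq ⟩
    V * (U * q * D + h * X ∸ h * X)  ≡⟨ cong (V *_) (m+n∸n≡m (U * q * D) (h * X)) ⟩
    V * (U * q * D)                  ≡⟨ swap V U q D ⟩
    U * (V * q * D)                  ∎)
    where
    open ≤-Reasoning
    g = h ∸ q
    X = v * w
    swap : ∀ U V g X → U * (V * g * X) ≡ V * (U * g * X)
    swap = solve-∀

  excess-bound : ∀ {V k} .{{_ : NonZero U}} .{{_ : NonZero w}} → V ≤ U → D ≤ k * w →
                 (V * (h ∸ q) ∸ h) * v ≤ V * (k * q)
  excess-bound {V} {k} V≤U D≤kw = *-cancelʳ-≤ _ _ w (begin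
    f * v * w        ≡⟨ *-assoc f v w ⟩
    f * (v * w)      ≤⟨ excess-mono V≤U ⟩
    V * q * D        ≤⟨ *-monoʳ-≤ (V * q) D≤kw ⟩
    V * q * (k * w)  ≡⟨ shuffle V q k w ⟩
    V * (k * q) * w  ∎)
    where
    open ≤-Reasoning
    f = V * (h ∸ q) ∸ h
    shuffle : ∀ V q k w → V * q * (k * w) ≡ V * (k * q) * w
    shuffle = solve-∀

-- All v ≥ lo allowed by excess-bound for the least square V with h < V g; this V is at most A²
-- whenever h < A² g, so the check needs no bound on A.
level : (g h c lo : ℕ) → (ℕ → Bool) → Bool
level zero      h c lo p = true
level g@(suc _) h c lo p = allWithin (V * g ∸ h) (V * c) lo p
  where
  V = rootAbove g h * rootAbove g h

level-sound : ∀ {A g h c lo v} (p : ℕ → Bool) → h < A * A * g →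
              (∀ {V} → V ≤ A * A → (V * g ∸ h) * v ≤ V * c) →
              T (level g h c lo p) → lo ≤ v → T (p v)
level-sound {A} {zero} {h} p h<0 _ _ _ = contradiction (subst (h <_) (*-zeroʳ (A * A)) h<0) n≮0
level-sound {A} {g@(suc _)} {h} {c} p h<AAg bound ok lo≤v =
  allWithin-sound {V * g ∸ h} {V * c} p ok lo≤v (bound (*-mono-≤ r≤A r≤A))
  where
  V = rootAbove g h * rootAbove g h
  r≤A = rootAbove-least {g} {h} {A} h<AAg

levelEq-sound : ∀ {A h q v w D k lo} (p : ℕ → Bool)
                .{{_ : NonZero A}} .{{_ : NonZero q}} .{{_ : NonZero w}} .{{_ : NonZero D}} →
                A * A * h * (v * w) ≡ A * A * q * (v * w + D) + h * (v * w) → D ≤ k * w →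
                T (level (h ∸ q) h (k * q) lo p) → lo ≤ v → T (p v)
levelEq-sound {A} {h} {q} {v} {w} {D} {k} p eq D≤kw =
  level-sound {A} p (excess-pos (>-nonZero⁻¹ (A * A * q * D) {{UqD≢0}}))
                    (λ V≤U → excess-bound {k = k} {{AA≢0}} V≤U D≤kw)
  where
  open Level {A * A} {h} {q} {v} {w} {D} eq
  AA≢0 = m*n≢0 A A
  UqD≢0 = m*n≢0 (A * A * q) D {{m*n≢0 (A * A) q {{AA≢0}}}}

Reduced : (U t a b c : ℕ) → Set
Reduced U t a b c = U * t * (a * b * c) ≡ U * ((2 + a) * (2 + b) * (2 + c)) + t * (a * b * c)

Reduced? : ∀ U t a b c → Dec (Reduced U t a b c)
Reduced? U t a b c = _ ≟ _

squared⇒reduced : ∀ {u t a b c} →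
  t * u * (a + a * (1 + a)) * (b + b * (1 + b)) * (c + c * (1 + c))
    ≡ (1 + u) * ((1 + a + 1) * (1 + a + 1)) * ((1 + b + 1) * (1 + b + 1)) * ((1 + c + 1) * (1 + c + 1)) →
  Reduced (1 + u) t a b c
squared⇒reduced {u} {t} {a} {b} {c} eq = *-cancelˡ-≡ _ _ N
  (trans (lhs u t a b c) (trans (cong (_+ t * (a * b * c) * N) eq) (rhs u t a b c)))
  where
  N = (2 + a) * (2 + b) * (2 + c)
  lhs : ∀ u t a b c → (2 + a) * (2 + b) * (2 + c) * ((1 + u) * t * (a * b * c))
        ≡ t * u * (a + a * (1 + a)) * (b + b * (1 + b)) * (c + c * (1 + c))
          + t * (a * b * c) * ((2 + a) * (2 + b) * (2 + c))
  lhs = solve-∀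
  rhs : ∀ u t a b c →
        (1 + u) * ((1 + a + 1) * (1 + a + 1)) * ((1 + b + 1) * (1 + b + 1)) * ((1 + c + 1) * (1 + c + 1))
          + t * (a * b * c) * ((2 + a) * (2 + b) * (2 + c))
        ≡ (2 + a) * (2 + b) * (2 + c) * ((1 + u) * ((2 + a) * (2 + b) * (2 + c)) + t * (a * b * c))
  rhs = solve-∀

-- For arguments ≥ 2 every factor of (∗) computes to +_ of a positive natural number, so +-injective
-- turns the integer equation into the natural-number one expected by squared⇒reduced.
perfect⇒reduced : ∀ {s α x y z} →
  RamanujanEq (ℤ.+ (2 + s)) (ℤ.+ (2 + α)) (ℤ.+ (2 + x)) (ℤ.+ (2 + y)) (ℤ.+ (2 + z)) →
  Reduced ((2 + α) * (2 + α)) (2 + s) (1 + x) (1 + y) (1 + z)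
perfect⇒reduced {s} {α} {x} {y} {z} E =
  squared⇒reduced {1 + α + (1 + α) * (2 + α)} {2 + s} {1 + x} {1 + y} {1 + z} (+-injective E)

-- (2 + b)(2 + c) = b c + δ₂ b c   and   (2 + a)(2 + b)(2 + c) = a b c + δ₃ a b c
δ₂ : ℕ → ℕ → ℕ
δ₂ b c = 2 * (2 + b + c)

δ₃ : ℕ → ℕ → ℕ → ℕ
δ₃ a b c = 2 * ((2 + b) * (2 + c)) + a * δ₂ b c

2+n≤3*n : ∀ {n} → 1 ≤ n → 2 + n ≤ 3 * n
2+n≤3*n {n} 1≤n = ≤-trans (+-monoˡ-≤ n (*-monoʳ-≤ 2 1≤n)) (≤-reflexive (2n+n≡3n n))
  where
  2n+n≡3n : ∀ n → 2 * n + n ≡ 3 * n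
  2n+n≡3n = solve-∀

δ₂≤8*c : ∀ {b c} → b ≤ c → 1 ≤ c → δ₂ b c ≤ 8 * c
δ₂≤8*c {b} {c} b≤c 1≤c =
  ≤-trans (*-monoʳ-≤ 2 (+-monoˡ-≤ c (+-mono-≤ (*-monoʳ-≤ 2 1≤c) b≤c))) (≤-reflexive (identity c))
  where
  identity : ∀ c → 2 * (2 * c + c + c) ≡ 8 * c
  identity = solve-∀

δ₃≤26*bc : ∀ {a b c} → a ≤ b → b ≤ c → 1 ≤ b → δ₃ a b c ≤ 26 * (b * c)
δ₃≤26*bc {a} {b} {c} a≤b b≤c 1≤b = ≤-trans
  (+-mono-≤ (*-monoʳ-≤ 2 (*-mono-≤ (2+n≤3*n 1≤b) (2+n≤3*n 1≤c))) (*-mono-≤ a≤b (δ₂≤8*c b≤c 1≤c)))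
  (≤-reflexive (identity b c))
  where
  1≤c = ≤-trans 1≤b b≤c
  identity : ∀ b c → 2 * (3 * b * (3 * c)) + b * (8 * c) ≡ 26 * (b * c)
  identity = solve-∀

module ReducedLevels {U t a b c : ℕ} (E : Reduced U t a b c) where

  levelA : U * t * (a * (b * c)) ≡ U * 1 * (a * (b * c) + δ₃ a b c) + t * (a * (b * c))
  levelA = trans (lhs U t a b c) (trans E (rhs U t a b c))
    where
    lhs : ∀ U t a b c → U * t * (a * (b * c)) ≡ U * t * (a * b * c)
    lhs = solve-∀
    rhs : ∀ U t a b c → U * ((2 + a) * (2 + b) * (2 + c)) + t * (a * b * c)
          ≡ U * 1 * (a * (b * c) + (2 * ((2 + b) * (2 + c)) + a * (2 * (2 + b + c)))) + t * (a * (b * c))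
    rhs = solve-∀

  levelB : U * (t * a) * (b * c) ≡ U * (2 + a) * (b * c + δ₂ b c) + t * a * (b * c)
  levelB = trans (lhs U t a b c) (trans E (rhs U t a b c))
    where
    lhs : ∀ U t a b c → U * (t * a) * (b * c) ≡ U * t * (a * b * c)
    lhs = solve-∀
    rhs : ∀ U t a b c → U * ((2 + a) * (2 + b) * (2 + c)) + t * (a * b * c)
          ≡ U * (2 + a) * (b * c + 2 * (2 + b + c)) + t * a * (b * c)
    rhs = solve-∀

  levelC : U * (t * a * b) * (c * 1) ≡ U * ((2 + a) * (2 + b)) * (c * 1 + 2) + t * a * b * (c * 1)
  levelC = trans (lhs U t a b c) (trans E (rhs U t a b c))
    where
    lhs : ∀ U t a b c → U * (t * a * b) * (c * 1) ≡ U * t * (a * b * c)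
    lhs = solve-∀
    rhs : ∀ U t a b c → U * ((2 + a) * (2 + b) * (2 + c)) + t * (a * b * c)
          ≡ U * ((2 + a) * (2 + b)) * (c * 1 + 2) + t * a * b * (c * 1)
    rhs = solve-∀

4*[t∸1]∸t≤104⇒t≤36 : ∀ {t} → 4 * (t ∸ 1) ∸ t ≤ 104 → t ≤ 36
4*[t∸1]∸t≤104⇒t≤36 {t} le = ≮⇒≥ λ 36<t → contra (m≤n⇒∃[o]m+o≡n 36<t)
  where
  contra : ∃ (λ k → 37 + k ≡ t) → ⊥
  contra (k , refl) = m+1+n≰m 104 (subst (_≤ 104) excess le)
    where
    split : ∀ k → 4 * (36 + k) ≡ 104 + suc (2 + 3 * k) + (37 + k)
    split = solve-∀
    excess : 4 * (36 + k) ∸ (37 + k) ≡ 104 + suc (2 + 3 * k)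
    excess = trans (cong (_∸ (37 + k)) (split k)) (m+n∸n≡m _ (37 + k))

Tupleℕ : Set
Tupleℕ = ℕ × ℕ × ℕ × ℕ × ℕ

_≟₅_ : DecidableEquality Tupleℕ
_≟₅_ = ≡-dec _≟_ (≡-dec _≟_ (≡-dec _≟_ (≡-dec _≟_ _≟_)))

open import Data.List.Membership.DecPropositional _≟₅_ using (_∈?_)

solutions : List Tupleℕ
solutions =
  (4 , 28 , 2 , 8 , 57) ∷ (4 , 14 , 2 , 8 , 64) ∷ (4 , 10 , 2 , 8 , 76) ∷ (4 , 8 , 2 , 8 , 97) ∷ (4 , 7 , 2 , 8 , 127)
  ∷ (4 , 6 , 2 , 8 , 244) ∷ (4 , 16 , 2 , 9 , 33) ∷ (4 , 8 , 2 , 9 , 41) ∷ (4 , 6 , 2 , 9 , 55) ∷ (4 , 12 , 2 , 10 , 25)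
  ∷ (4 , 10 , 2 , 10 , 26) ∷ (4 , 6 , 2 , 10 , 34) ∷ (4 , 4 , 2 , 10 , 89) ∷ (4 , 10 , 2 , 11 , 21) ∷ (4 , 5 , 2 , 11 , 31)
  ∷ (4 , 4 , 2 , 11 , 49) ∷ (4 , 3 , 2 , 12 , 703) ∷ (4 , 8 , 2 , 13 , 17) ∷ (4 , 6 , 2 , 13 , 19) ∷ (4 , 4 , 2 , 13 , 29)
  ∷ (4 , 3 , 2 , 13 , 127) ∷ (4 , 26 , 2 , 14 , 14) ∷ (4 , 4 , 2 , 14 , 25) ∷ (4 , 7 , 2 , 15 , 15) ∷ (4 , 3 , 2 , 15 , 55)
  ∷ (4 , 4 , 2 , 17 , 19) ∷ (4 , 3 , 2 , 19 , 31) ∷ (5 , 10 , 2 , 5 , 21) ∷ (5 , 5 , 2 , 5 , 31) ∷ (5 , 4 , 2 , 5 , 49)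
  ∷ (5 , 5 , 2 , 6 , 15) ∷ (5 , 5 , 2 , 7 , 11) ∷ (5 , 3 , 2 , 7 , 19) ∷ (5 , 4 , 2 , 9 , 9) ∷ (5 , 2 , 2 , 10 , 89)
  ∷ (5 , 2 , 2 , 11 , 49) ∷ (5 , 2 , 2 , 13 , 29) ∷ (5 , 2 , 2 , 14 , 25) ∷ (5 , 2 , 2 , 17 , 19) ∷ (6 , 6 , 2 , 4 , 13)
  ∷ (6 , 4 , 2 , 4 , 17) ∷ (6 , 3 , 2 , 4 , 31) ∷ (6 , 4 , 2 , 5 , 9) ∷ (6 , 2 , 2 , 6 , 29) ∷ (6 , 3 , 2 , 7 , 7)
  ∷ (6 , 2 , 2 , 7 , 17) ∷ (6 , 2 , 2 , 8 , 13) ∷ (6 , 2 , 2 , 9 , 11) ∷ (7 , 7 , 2 , 3 , 15) ∷ (7 , 3 , 2 , 3 , 55)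
  ∷ (7 , 2 , 2 , 4 , 41) ∷ (7 , 2 , 2 , 5 , 13) ∷ (7 , 2 , 2 , 6 , 9) ∷ (8 , 4 , 2 , 3 , 9) ∷ (8 , 4 , 2 , 4 , 5)
  ∷ (8 , 2 , 2 , 4 , 11) ∷ (8 , 2 , 2 , 5 , 7) ∷ (9 , 3 , 2 , 3 , 7) ∷ (9 , 2 , 2 , 3 , 17) ∷ (9 , 2 , 2 , 5 , 5)
  ∷ (10 , 10 , 2 , 2 , 21) ∷ (10 , 5 , 2 , 2 , 31) ∷ (10 , 4 , 2 , 2 , 49) ∷ (10 , 2 , 2 , 3 , 9) ∷ (10 , 2 , 2 , 4 , 5)
  ∷ (12 , 4 , 2 , 2 , 9) ∷ (12 , 2 , 2 , 3 , 5) ∷ (13 , 2 , 2 , 2 , 25) ∷ (14 , 2 , 2 , 2 , 13) ∷ (15 , 2 , 2 , 2 , 9)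
  ∷ (16 , 4 , 2 , 2 , 4) ∷ (16 , 2 , 2 , 2 , 7) ∷ (16 , 2 , 2 , 3 , 3) ∷ (18 , 2 , 2 , 2 , 5) ∷ (20 , 2 , 2 , 2 , 4)
  ∷ (24 , 2 , 2 , 2 , 3) ∷ (36 , 2 , 2 , 2 , 2) ∷ (3 , 15 , 3 , 6 , 31) ∷ (3 , 6 , 3 , 6 , 49) ∷ (3 , 5 , 3 , 6 , 71)
  ∷ (3 , 4 , 3 , 6 , 449) ∷ (3 , 9 , 3 , 7 , 19) ∷ (3 , 5 , 3 , 7 , 26) ∷ (3 , 7 , 3 , 8 , 15) ∷ (3 , 3 , 3 , 8 , 55)
  ∷ (3 , 6 , 3 , 9 , 13) ∷ (3 , 4 , 3 , 9 , 17) ∷ (3 , 3 , 3 , 9 , 31) ∷ (3 , 3 , 3 , 10 , 23) ∷ (3 , 5 , 3 , 11 , 11)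
  ∷ (3 , 3 , 3 , 11 , 19) ∷ (3 , 3 , 3 , 13 , 15) ∷ (3 , 2 , 3 , 18 , 305) ∷ (3 , 2 , 3 , 19 , 161) ∷ (3 , 2 , 3 , 20 , 113)
  ∷ (3 , 2 , 3 , 21 , 89) ∷ (3 , 2 , 3 , 23 , 65) ∷ (3 , 2 , 3 , 25 , 53) ∷ (3 , 2 , 3 , 26 , 49) ∷ (3 , 2 , 3 , 29 , 41)
  ∷ (3 , 2 , 3 , 33 , 35) ∷ (4 , 6 , 3 , 4 , 13) ∷ (4 , 4 , 3 , 4 , 17) ∷ (4 , 3 , 3 , 4 , 31) ∷ (4 , 4 , 3 , 5 , 9)
  ∷ (4 , 2 , 3 , 6 , 29) ∷ (4 , 3 , 3 , 7 , 7) ∷ (4 , 2 , 3 , 7 , 17) ∷ (4 , 2 , 3 , 8 , 13) ∷ (4 , 2 , 3 , 9 , 11)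
  ∷ (5 , 5 , 3 , 3 , 11) ∷ (5 , 3 , 3 , 3 , 19) ∷ (5 , 3 , 3 , 4 , 7) ∷ (5 , 2 , 3 , 4 , 17) ∷ (5 , 2 , 3 , 5 , 9)
  ∷ (6 , 3 , 3 , 3 , 7) ∷ (6 , 2 , 3 , 3 , 17) ∷ (6 , 2 , 3 , 5 , 5) ∷ (8 , 2 , 3 , 3 , 5) ∷ (9 , 3 , 3 , 3 , 3)
  ∷ (2 , 66 , 4 , 12 , 133) ∷ (2 , 14 , 4 , 12 , 197) ∷ (2 , 12 , 4 , 12 , 241) ∷ (2 , 11 , 4 , 12 , 287) ∷ (2 , 9 , 4 , 12 , 703)
  ∷ (2 , 36 , 4 , 13 , 73) ∷ (2 , 9 , 4 , 13 , 127) ∷ (2 , 8 , 4 , 13 , 161) ∷ (2 , 26 , 4 , 14 , 53) ∷ (2 , 6 , 4 , 14 , 181)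
  ∷ (2 , 21 , 4 , 15 , 43) ∷ (2 , 9 , 4 , 15 , 55) ∷ (2 , 7 , 4 , 15 , 71) ∷ (2 , 6 , 4 , 15 , 97) ∷ (2 , 5 , 4 , 15 , 251)
  ∷ (2 , 18 , 4 , 16 , 37) ∷ (2 , 6 , 4 , 16 , 69) ∷ (2 , 16 , 4 , 17 , 33) ∷ (2 , 8 , 4 , 17 , 41) ∷ (2 , 6 , 4 , 17 , 55)
  ∷ (2 , 4 , 4 , 18 , 305) ∷ (2 , 9 , 4 , 19 , 31) ∷ (2 , 6 , 4 , 19 , 41) ∷ (2 , 4 , 4 , 19 , 161) ∷ (2 , 6 , 4 , 20 , 37)
  ∷ (2 , 4 , 4 , 20 , 113) ∷ (2 , 12 , 4 , 21 , 25) ∷ (2 , 10 , 4 , 21 , 26) ∷ (2 , 6 , 4 , 21 , 34) ∷ (2 , 4 , 4 , 21 , 89)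
  ∷ (2 , 11 , 4 , 23 , 23) ∷ (2 , 4 , 4 , 23 , 65) ∷ (2 , 6 , 4 , 25 , 27) ∷ (2 , 4 , 4 , 25 , 53) ∷ (2 , 5 , 4 , 26 , 31)
  ∷ (2 , 4 , 4 , 26 , 49) ∷ (2 , 4 , 4 , 29 , 41) ∷ (2 , 3 , 4 , 32 , 991) ∷ (2 , 4 , 4 , 33 , 35) ∷ (2 , 3 , 4 , 33 , 511)
  ∷ (2 , 3 , 4 , 34 , 351) ∷ (2 , 3 , 4 , 35 , 271) ∷ (2 , 3 , 4 , 36 , 223) ∷ (2 , 3 , 4 , 37 , 191) ∷ (2 , 3 , 4 , 39 , 151)
  ∷ (2 , 3 , 4 , 41 , 127) ∷ (2 , 3 , 4 , 43 , 111) ∷ (2 , 3 , 4 , 46 , 95) ∷ (2 , 3 , 4 , 47 , 91) ∷ (2 , 3 , 4 , 51 , 79)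
  ∷ (2 , 3 , 4 , 55 , 71) ∷ (2 , 3 , 4 , 61 , 63) ∷ (3 , 9 , 4 , 4 , 31) ∷ (3 , 6 , 4 , 4 , 41) ∷ (3 , 4 , 4 , 4 , 161)
  ∷ (3 , 6 , 4 , 5 , 13) ∷ (3 , 4 , 4 , 5 , 17) ∷ (3 , 3 , 4 , 5 , 31) ∷ (3 , 6 , 4 , 6 , 9) ∷ (3 , 3 , 4 , 6 , 15)
  ∷ (3 , 9 , 4 , 7 , 7) ∷ (3 , 3 , 4 , 7 , 11) ∷ (3 , 2 , 4 , 7 , 161) ∷ (3 , 2 , 4 , 8 , 41) ∷ (3 , 2 , 4 , 9 , 26)
  ∷ (3 , 2 , 4 , 11 , 17) ∷ (4 , 6 , 4 , 4 , 6) ∷ (4 , 2 , 4 , 4 , 26) ∷ (4 , 4 , 4 , 5 , 5) ∷ (4 , 2 , 4 , 5 , 11)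
  ∷ (4 , 2 , 4 , 6 , 8) ∷ (5 , 2 , 4 , 5 , 5) ∷ (2 , 28 , 5 , 8 , 57) ∷ (2 , 14 , 5 , 8 , 64) ∷ (2 , 10 , 5 , 8 , 76)
  ∷ (2 , 8 , 5 , 8 , 97) ∷ (2 , 7 , 5 , 8 , 127) ∷ (2 , 6 , 5 , 8 , 244) ∷ (2 , 16 , 5 , 9 , 33) ∷ (2 , 8 , 5 , 9 , 41)
  ∷ (2 , 6 , 5 , 9 , 55) ∷ (2 , 12 , 5 , 10 , 25) ∷ (2 , 10 , 5 , 10 , 26) ∷ (2 , 6 , 5 , 10 , 34) ∷ (2 , 4 , 5 , 10 , 89)
  ∷ (2 , 10 , 5 , 11 , 21) ∷ (2 , 5 , 5 , 11 , 31) ∷ (2 , 4 , 5 , 11 , 49) ∷ (2 , 3 , 5 , 12 , 703) ∷ (2 , 8 , 5 , 13 , 17)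
  ∷ (2 , 6 , 5 , 13 , 19) ∷ (2 , 4 , 5 , 13 , 29) ∷ (2 , 3 , 5 , 13 , 127) ∷ (2 , 26 , 5 , 14 , 14) ∷ (2 , 4 , 5 , 14 , 25)
  ∷ (2 , 7 , 5 , 15 , 15) ∷ (2 , 3 , 5 , 15 , 55) ∷ (2 , 4 , 5 , 17 , 19) ∷ (2 , 3 , 5 , 19 , 31) ∷ (3 , 4 , 5 , 5 , 9)
  ∷ (3 , 2 , 5 , 6 , 29) ∷ (3 , 3 , 5 , 7 , 7) ∷ (3 , 2 , 5 , 7 , 17) ∷ (3 , 2 , 5 , 8 , 13) ∷ (3 , 2 , 5 , 9 , 11)
  ∷ (4 , 2 , 5 , 5 , 7) ∷ (2 , 50 , 6 , 6 , 101) ∷ (2 , 20 , 6 , 6 , 113) ∷ (2 , 15 , 6 , 6 , 127) ∷ (2 , 10 , 6 , 6 , 197)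
  ∷ (2 , 8 , 6 , 6 , 449) ∷ (2 , 15 , 6 , 7 , 31) ∷ (2 , 6 , 6 , 7 , 49) ∷ (2 , 5 , 6 , 7 , 71) ∷ (2 , 4 , 6 , 7 , 449)
  ∷ (2 , 10 , 6 , 8 , 21) ∷ (2 , 5 , 6 , 8 , 31) ∷ (2 , 4 , 6 , 8 , 49) ∷ (2 , 8 , 6 , 9 , 17) ∷ (2 , 6 , 6 , 9 , 19)
  ∷ (2 , 4 , 6 , 9 , 29) ∷ (2 , 3 , 6 , 9 , 127) ∷ (2 , 5 , 6 , 11 , 15) ∷ (2 , 3 , 6 , 15 , 19) ∷ (2 , 2 , 6 , 30 , 869)
  ∷ (2 , 2 , 6 , 31 , 449) ∷ (2 , 2 , 6 , 32 , 309) ∷ (2 , 2 , 6 , 33 , 239) ∷ (2 , 2 , 6 , 34 , 197) ∷ (2 , 2 , 6 , 35 , 169)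
  ∷ (2 , 2 , 6 , 36 , 149) ∷ (2 , 2 , 6 , 37 , 134) ∷ (2 , 2 , 6 , 39 , 113) ∷ (2 , 2 , 6 , 41 , 99) ∷ (2 , 2 , 6 , 43 , 89)
  ∷ (2 , 2 , 6 , 44 , 85) ∷ (2 , 2 , 6 , 49 , 71) ∷ (2 , 2 , 6 , 50 , 69) ∷ (2 , 2 , 6 , 53 , 64) ∷ (2 , 2 , 6 , 57 , 59)
  ∷ (3 , 2 , 6 , 8 , 9) ∷ (2 , 9 , 7 , 7 , 19) ∷ (2 , 5 , 7 , 7 , 26) ∷ (2 , 7 , 7 , 8 , 15) ∷ (2 , 3 , 7 , 8 , 55)
  ∷ (2 , 6 , 7 , 9 , 13) ∷ (2 , 4 , 7 , 9 , 17) ∷ (2 , 3 , 7 , 9 , 31) ∷ (2 , 3 , 7 , 10 , 23) ∷ (2 , 5 , 7 , 11 , 11)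
  ∷ (2 , 3 , 7 , 11 , 19) ∷ (2 , 3 , 7 , 13 , 15) ∷ (2 , 2 , 7 , 18 , 305) ∷ (2 , 2 , 7 , 19 , 161) ∷ (2 , 2 , 7 , 20 , 113)
  ∷ (2 , 2 , 7 , 21 , 89) ∷ (2 , 2 , 7 , 23 , 65) ∷ (2 , 2 , 7 , 25 , 53) ∷ (2 , 2 , 7 , 26 , 49) ∷ (2 , 2 , 7 , 29 , 41)
  ∷ (2 , 2 , 7 , 33 , 35) ∷ (2 , 4 , 8 , 9 , 13) ∷ (2 , 2 , 8 , 14 , 181) ∷ (2 , 2 , 8 , 15 , 97) ∷ (2 , 2 , 8 , 16 , 69)
  ∷ (2 , 2 , 8 , 17 , 55) ∷ (2 , 2 , 8 , 19 , 41) ∷ (2 , 2 , 8 , 20 , 37) ∷ (2 , 2 , 8 , 21 , 34) ∷ (2 , 2 , 8 , 25 , 27)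
  ∷ (2 , 4 , 9 , 9 , 11) ∷ (2 , 2 , 9 , 12 , 131) ∷ (2 , 2 , 9 , 13 , 71) ∷ (2 , 2 , 9 , 14 , 51) ∷ (2 , 2 , 9 , 15 , 41)
  ∷ (2 , 2 , 9 , 16 , 35) ∷ (2 , 2 , 9 , 17 , 31) ∷ (2 , 2 , 9 , 19 , 26) ∷ (2 , 2 , 9 , 21 , 23) ∷ (2 , 2 , 10 , 10 , 485)
  ∷ (2 , 2 , 10 , 11 , 89) ∷ (2 , 2 , 10 , 12 , 53) ∷ (2 , 2 , 10 , 17 , 23) ∷ (2 , 2 , 11 , 11 , 49) ∷ (2 , 2 , 11 , 13 , 29)
  ∷ (2 , 2 , 11 , 14 , 25) ∷ (2 , 2 , 11 , 17 , 19) ∷ (2 , 2 , 12 , 14 , 21) ∷ (2 , 2 , 13 , 15 , 17)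
  ∷ []

-- A solution satisfies A² (m − (2 + a)(2 + b)(2 + c)) = m with m = t abc, and then the least r
-- with m < r² (m − (2 + a)(2 + b)(2 + c)) is A + 1.
candidateRoot : (t a b c : ℕ) → ℕ
candidateRoot t a b c = pred (rootAbove (m ∸ (2 + a) * (2 + b) * (2 + c)) m)
  where
  m = t * (a * b * c)

ListedIfSolution : (A t a b c : ℕ) → Set
ListedIfSolution A t a b c = Reduced (A * A) t a b c → (t , A , 1 + a , 1 + b , 1 + c) ∈ solutions

listedIfSolution? : ∀ A t a b c → Dec (ListedIfSolution A t a b c)
listedIfSolution? A t a b c = Reduced? (A * A) t a b c →-dec ((t , A , 1 + a , 1 + b , 1 + c) ∈? solutions)

coveredTABC : (t a b c : ℕ) → Bool
coveredTABC t a b c = isYes (listedIfSolution? (candidateRoot t a b c) t a b c)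

coveredTAB : (t a b : ℕ) → Bool
coveredTAB t a b =
  level (t * a * b ∸ (2 + a) * (2 + b)) (t * a * b) (2 * ((2 + a) * (2 + b))) b (coveredTABC t a b)

coveredTA : (t a : ℕ) → Bool
coveredTA t a = level (t * a ∸ (2 + a)) (t * a) (8 * (2 + a)) a (coveredTAB t a)

coveredT : ℕ → Bool
coveredT t = level (t ∸ 1) t 26 1 (coveredTA t)

search-succeeds : T (all coveredT (interval 2 36))
search-succeeds = tt

candidateRoot-correct : ∀ {A t a b c} .{{_ : NonZero (t * (a * b * c))}} →
                        Reduced (A * A) t a b c → candidateRoot t a b c ≡ A
candidateRoot-correct {A} {t} {a} {b} {c} E =
  cong pred (trans (cong (rootAbove d) (sym Ad≡m)) (rootAbove-exact A d {{d≢0}}))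
  where
  m = t * (a * b * c)
  N = (2 + a) * (2 + b) * (2 + c)
  d = m ∸ N
  Ad≡m : A * A * d ≡ m
  Ad≡m = begin
    A * A * (m ∸ N)            ≡⟨ *-distribˡ-∸ (A * A) m N ⟩
    A * A * m ∸ A * A * N      ≡⟨ cong (_∸ A * A * N) (trans (sym (*-assoc (A * A) t (a * b * c))) E) ⟩
    A * A * N + m ∸ A * A * N  ≡⟨ m+n∸m≡n (A * A * N) m ⟩
    m                          ∎
    where open ≡-Reasoning
  d≢0 : NonZero d
  d≢0 = ≢-nonZero λ d≡0 →
    ≢-nonZero⁻¹ m (trans (sym Ad≡m) (trans (cong (A * A *_) d≡0) (*-zeroʳ (A * A))))

candidate-listed : ∀ {A t a b c} .{{_ : NonZero (t * (a * b * c))}} → Reduced (A * A) t a b c →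
                   T (coveredTABC t a b c) → (t , A , 1 + a , 1 + b , 1 + c) ∈ solutions
candidate-listed {A} {t} {a} {b} {c} E ok =
  toWitness {a? = listedIfSolution? A t a b c}
    (subst (λ r → T (isYes (listedIfSolution? r t a b c))) (candidateRoot-correct {A} {t} {a} {b} {c} E) ok) E

perfect-listed : ∀ {A t a b c} .{{_ : NonZero A}} .{{_ : NonZero a}} .{{_ : NonZero b}} .{{_ : NonZero c}} →
                 2 ≤ A → 2 ≤ t → a ≤ b → b ≤ c → Reduced (A * A) t a b c →
                 (t , A , 1 + a , 1 + b , 1 + c) ∈ solutions
perfect-listed {A} {t} {a} {b} {c} 2≤A 2≤t a≤b b≤c E =
  candidate-listed {A} {t} {a} {b} {c} E
    (levelEq-sound {k = 2} {lo = b} (coveredTABC t a b) levelC ≤-refl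
      (levelEq-sound {k = 8} {lo = a} (coveredTAB t a) levelB (δ₂≤8*c b≤c 1≤c)
        (levelEq-sound {k = 26} {lo = 1} (coveredTA t) levelA δ₃-bound
          (all-interval coveredT search-succeeds 2≤t (4*[t∸1]∸t≤104⇒t≤36 t-excess))
          1≤a)
        a≤b)
      b≤c)
  where
  instance
    _ = m*n≢0 A A
    _ = m*n≢0 b c
    _ = m*n≢0 c 1
    _ = m*n≢0 t (a * b * c) {{>-nonZero (≤-trans (s≤s z≤n) 2≤t)}} {{m*n≢0 (a * b) c {{m*n≢0 a b}}}}
  open ReducedLevels {A * A} {t} {a} {b} {c} E
  1≤a = >-nonZero⁻¹ a
  1≤c = >-nonZero⁻¹ c
  δ₃-bound = δ₃≤26*bc a≤b b≤c (>-nonZero⁻¹ b)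
  t-excess : 4 * (t ∸ 1) ∸ t ≤ 104
  t-excess = ≤-trans (m≤m*n _ a) (Level.excess-bound levelA {4} {26} (*-mono-≤ 2≤A 2≤A) δ₃-bound)

toℤ : Tupleℕ → Tuple
toℤ (t , A , x , y , z) = (ℤ.+ t , ℤ.+ A , ℤ.+ x , ℤ.+ y , ℤ.+ z)

perfect∈ : ∀ τ → Perfect τ → τ ∈ map toℤ solutions
perfect∈ _ (+<+ (s≤s (s≤s {n = s} z≤n)) , +<+ (s≤s (s≤s {n = α} z≤n)) ,
            +<+ (s≤s (s≤s {n = x} z≤n)) , +<+ (s≤s (s≤s {n = y} z≤n)) , +<+ (s≤s (s≤s {n = z} z≤n)) ,
            +≤+ (s≤s (s≤s x≤y)) , +≤+ (s≤s (s≤s y≤z)) , E) =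
  ∈-map⁺ toℤ (perfect-listed {2 + α} {2 + s} {1 + x} {1 + y} {1 + z}
                (s≤s (s≤s z≤n)) (s≤s (s≤s z≤n)) (s≤s x≤y) (s≤s y≤z)
                (perfect⇒reduced {s} {α} {x} {y} {z} E))

family : ℕ → Tuple
family n = (ℤ.+ 2 , ℤ.+ 2 , ℤ.+ (2 + n) , ℤ.+ 5 , ℤ.- ℤ.+ (2 + n))

family-eq : ∀ x → RamanujanEq (ℤ.+ 2) (ℤ.+ 2) x (ℤ.+ 5) (ℤ.- x)
family-eq = identity
  where
  identity : ∀ x →
    ℤ.+ 2 ℤ.* (ℤ.+ 2 ℤ.* ℤ.+ 2 ℤ.- ℤ.+ 1) ℤ.* (x ℤ.* x ℤ.- ℤ.+ 1)
      ℤ.* (ℤ.+ 5 ℤ.* ℤ.+ 5 ℤ.- ℤ.+ 1) ℤ.* (ℤ.- x ℤ.* ℤ.- x ℤ.- ℤ.+ 1)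
    ≡ ℤ.+ 2 ℤ.* ℤ.+ 2 ℤ.* ((x ℤ.+ ℤ.+ 1) ℤ.* (x ℤ.+ ℤ.+ 1))
      ℤ.* ((ℤ.+ 5 ℤ.+ ℤ.+ 1) ℤ.* (ℤ.+ 5 ℤ.+ ℤ.+ 1)) ℤ.* ((ℤ.- x ℤ.+ ℤ.+ 1) ℤ.* (ℤ.- x ℤ.+ ℤ.+ 1))
  identity = ℤSolver.solve-∀

+[2+n]-notUnitOrZero : ∀ n → NotUnitOrZero (ℤ.+ (2 + n))
+[2+n]-notUnitOrZero n (inj₁ ())
+[2+n]-notUnitOrZero n (inj₂ (inj₁ ()))
+[2+n]-notUnitOrZero n (inj₂ (inj₂ ()))

-[2+n]-notUnitOrZero : ∀ n → NotUnitOrZero (ℤ.- ℤ.+ (2 + n))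
-[2+n]-notUnitOrZero n (inj₁ ())
-[2+n]-notUnitOrZero n (inj₂ (inj₁ ()))
-[2+n]-notUnitOrZero n (inj₂ (inj₂ ()))

family-general : ∀ n → General (family n)
family-general n = (λ ()) , +[2+n]-notUnitOrZero 0 , +[2+n]-notUnitOrZero n , +[2+n]-notUnitOrZero 3 ,
                   -[2+n]-notUnitOrZero n , family-eq (ℤ.+ (2 + n))

xBound : List Tuple → ℕ
xBound []                        = 0
xBound ((_ , _ , x , _ , _) ∷ L) = ℤ.∣ x ∣ + xBound L

∣x∣≤xBound : ∀ {t A x y z L} → (t , A , x , y , z) ∈ L → ℤ.∣ x ∣ ≤ xBound L
∣x∣≤xBound (here refl)              = m≤m+n _ _
∣x∣≤xBound {L = _ ∷ L} (there τ∈L) = ≤-trans (∣x∣≤xBound τ∈L) (m≤n+m (xBound L) _)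

family∉ : ∀ L → family (xBound L) ∉ L
family∉ L τ∈L = 1+n≰n (≤-trans (n≤1+n _) (∣x∣≤xBound τ∈L))

theorem1p2 : (Σ (List Tuple) (λ L → ∀ (τ : Tuple) → Perfect τ → τ ∈ L))
    × (∀ (L : List Tuple) → Σ Tuple (λ τ → General τ × τ ∉ L))
theorem1p2 =
  (map toℤ solutions , perfect∈) , λ L → family (xBound L) , family-general (xBound L) , family∉ L
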